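{- Every infinite messy ladder either has an infinite maximal sequence of pairwise independent full crosses or contains as an induced subgraph an infinite cross-free ladder.
   Context: On a ray, $a\le b$ ($a<b$) means $a$ lies on the subpath from the initial vertex to $b$ (and $a\neq b$); $W[a,b]$ denotes that subpath. Two rays are in the same end if there are infinitely many pairwise disjoint paths joining them. An infinite messy ladder is a triple $(L,W,X)$ where $L$ is a locally finite graph all of whose vertices lie on two disjoint induced rays $W,X$ of $L$ (rails) which are in the same end of $L$, and $L$ has an edge between the initial vertices of $W$ and $X$. Edges not on $W$ or $X$ are rungs; for a rung $e$, $e_W$ and $e_X$ are its ends on $W$ and $X$. An ordered pair of rungs $(e,f)$ is a cross if $e_W<f_W$ and $f_X<e_X$; its $W$-span is $W[e_W,f_W]$ and its $X$-span is $X[f_X,e_X]$. A cross is full if the ladder has no other cross whose $W$-span contains its $W$-span and whose $X$-span contains its $X$-span. Two crosses are independent if their $W$-spans are edge-disjoint and their $X$-spans are edge-disjoint. A sequence of pairwise independent full crosses is maximal if it is not a proper subsequence of any other sequence of pairwise independent full crosses. An infinite cross-free ladder is an infinite messy ladder in which no two rungs cross. -}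

module Defs where

open import Level using (0ℓ)
open import Data.Nat using (ℕ; zero; suc; _≤_; _<_)
open import Data.Fin using (Fin; zero; suc; inject₁; fromℕ)
open import Data.Bool using (Bool; T)
open import Data.List using (List)
open import Data.List.Membership.Propositional using (_∈_)
open import Data.Product using (Σ; ∃; ∃-syntax; _×_; _,_; proj₁; proj₂)
open import Data.Sum using (_⊎_)
open import Data.Empty using (⊥)
open import Relation.Nullary using (¬_)
open import Relation.Binary.PropositionalEquality using (_≡_; _≢_)

record Graph : Set₁ where
  field
    V      : Set
    Adj    : V → V → Set
    sym    : ∀ {u v} → Adj u v → Adj v u
    irrefl : ∀ {v} → ¬ Adj v v
open Graph public

module _ (G : Graph) where

  LocallyFinite : Set
  LocallyFinite = ∀ v → Σ (List (V G)) λ ns → ∀ u → Adj G v u → u ∈ ns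

  IsRay : (ℕ → V G) → Set
  IsRay r = (∀ i j → r i ≡ r j → i ≡ j) × (∀ i → Adj G (r i) (r (suc i)))

  InducedRay : (ℕ → V G) → Set
  InducedRay r = IsRay r × (∀ i j → Adj G (r i) (r j) → (j ≡ suc i) ⊎ (i ≡ suc j))

  record Path : Set where
    field
      len : ℕ
      vtx : Fin (suc len) → V G
      inj : ∀ a b → vtx a ≡ vtx b → a ≡ b
      adj : ∀ (a : Fin len) → Adj G (vtx (inject₁ a)) (vtx (suc a))
  open Path public

  Joins : (ℕ → V G) → (ℕ → V G) → Path → Set
  Joins W X P = (∃[ a ] vtx P zero ≡ W a) × (∃[ b ] vtx P (fromℕ (len P)) ≡ X b)

  VertexDisjoint : Path → Path → Set
  VertexDisjoint P Q = ∀ a b → vtx P a ≢ vtx Q b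

  SameEnd : (ℕ → V G) → (ℕ → V G) → Set
  SameEnd W X = Σ (ℕ → Path) λ P →
    (∀ n → Joins W X (P n)) × (∀ m n → m ≢ n → VertexDisjoint (P m) (P n))

  record MessyLadder (W X : ℕ → V G) : Set where
    field
      locFin   : LocallyFinite
      railW    : InducedRay W
      railX    : InducedRay X
      disjoint : ∀ i j → W i ≢ X j
      covers   : ∀ v → (∃[ i ] v ≡ W i) ⊎ (∃[ j ] v ≡ X j)
      sameEnd  : SameEnd W X
      initial  : Adj G (W 0) (X 0)

  module _ (W X : ℕ → V G) where

    -- A rung (edge on neither rail).  Since all vertices lie on the
    -- disjoint induced rails, rungs are exactly the edges W i -- X j;
    -- we record a rung e by e_W = W i and e_X = X j (the order on a ray
    -- is the order of indices).
    record Rung : Set where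
      constructor rung
      field
        wi  : ℕ
        xj  : ℕ
        edg : Adj G (W wi) (X xj)
    open Rung public

    record Cross : Set where
      constructor cross
      field
        e    : Rung
        f    : Rung
        ltW  : wi e < wi f
        ltX  : xj f < xj e
    open Cross public

    -- W-span = W[e_W, f_W], X-span = X[f_X, e_X]  (as index intervals)
    wlo whi xlo xhi : Cross → ℕ
    wlo c = wi (e c)
    whi c = wi (f c)
    xlo c = xj (f c)
    xhi c = xj (e c)

    -- same cross (same pair of rungs; a rung is determined by its ends)
    SameCross : Cross → Cross → Set
    SameCross c d = (wlo c ≡ wlo d) × (whi c ≡ whi d) × (xlo c ≡ xlo d) × (xhi c ≡ xhi d)

    SpansContain : Cross → Cross → Set
    SpansContain c d = (wlo c ≤ wlo d) × (whi d ≤ whi c) × (xlo c ≤ xlo d) × (xhi d ≤ xhi c)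

    Full : Cross → Set
    Full c = ∀ d → SpansContain d c → SameCross d c

    -- W-spans edge-disjoint and X-spans edge-disjoint
    Independent : Cross → Cross → Set
    Independent c d = ((whi c ≤ wlo d) ⊎ (whi d ≤ wlo c)) × ((xhi c ≤ xlo d) ⊎ (xhi d ≤ xlo c))

    IndepFullSeq : (ℕ → Cross) → Set
    IndepFullSeq s = (∀ n → Full (s n)) × (∀ m n → m ≢ n → Independent (s m) (s n))

    ProperSubseq : (ℕ → Cross) → (ℕ → Cross) → Set
    ProperSubseq s t = Σ (ℕ → ℕ) λ g →
      (∀ n → g n < g (suc n)) × (∀ n → SameCross (s n) (t (g n))) × (∃[ m ] ∀ n → g n ≢ m)

    -- maximal: not a proper subsequence of any other sequence of pairwise
    -- independent full crosses (a finite sequence cannot contain an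
    -- infinite one, so only infinite competitors need to be considered)
    Maximal : (ℕ → Cross) → Set
    Maximal s = ¬ (Σ (ℕ → Cross) λ t → IndepFullSeq t × ProperSubseq s t)

    CrossFree : Set
    CrossFree = ¬ Cross

InducedSubgraph : (G : Graph) → (V G → Bool) → Graph
InducedSubgraph G S = record
  { V      = Σ (V G) λ v → T (S v)
  ; Adj    = λ u v → Adj G (proj₁ u) (proj₁ v)
  ; sym    = sym G
  ; irrefl = irrefl G
  }

-- Greedily pick, among the full crosses independent of all crosses picked so far, one whose
-- W-span ends earliest.  If this never gets stuck, the W-spans of the picks move off to infinity,
-- so a full cross independent of all of them would have been picked ahead of one of them: the
-- sequence is maximal.  If it gets stuck, every full cross starts on W or on X inside the finitely
-- many picked spans, so by local finiteness full crosses, and hence all crosses (each lies in a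
-- full one), end on W before some bound.  Since the rails are in one end there are rungs
-- arbitrarily far out, and the rails beyond such a rung induce a messy ladder without crosses.
module Submission where

open import Defs
open import Level using (0ℓ)
open import Axiom.ExcludedMiddle using (ExcludedMiddle)
open import Data.Nat using (ℕ)
open import Data.Bool using (Bool)
open import Data.Product using (Σ; _×_)
open import Data.Sum using (_⊎_)

open import Data.Nat using (zero; suc; _+_; _∸_; _≤_; _<_; _⊔_; z≤n; s≤s; _≤?_; _≟_)
open import Data.Nat.Properties
open import Data.Nat.Induction using (<-rec)
open import Data.Bool using (T)
open import Data.Bool.Properties using (T-irrelevant)
open import Data.Product using (_,_; proj₁; proj₂; ∃-syntax)
open import Data.Sum using (inj₁; inj₂)
import Data.Sum as Sum
open import Data.Empty using (⊥-elim)
open import Data.Maybe using (Maybe; just; nothing)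
import Data.Maybe.Relation.Unary.Any as Maybe
open import Data.List using (List; []; _∷_; mapMaybe)
open import Data.List.Relation.Unary.All using (All; []; _∷_) renaming (lookup to All-lookup)
open import Data.List.Relation.Unary.Any using (here; there)
import Data.List.Relation.Unary.Any as Any
open import Data.List.Relation.Unary.Any.Properties using (mapMaybe⁺; map⁺)
open import Data.List.Membership.Propositional using (_∈_)
open import Data.Fin using (Fin; zero; suc; inject₁; fromℕ)
open import Function using (_∘_)
open import Function.Definitions using (Injective)
open import Relation.Nullary using (¬_; Dec; yes; no)
open import Relation.Nullary.Decidable using (isYes; fromWitness; toWitness; decidable-stable; T?)
open import Relation.Binary.Definitions using (Tri; tri<; tri≈; tri>)
open import Relation.Binary.PropositionalEquality using (_≡_; _≢_; refl; trans; cong; subst; subst₂)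
import Relation.Binary.PropositionalEquality as ≡

+-squeeze : ∀ {x x′ y y′} → x ≤ x′ → y ≤ y′ → x′ + y′ ≤ x + y → x ≡ x′ × y ≡ y′
+-squeeze {x} {x′} {y} {y′} x≤x′ y≤y′ sum≤ =
  ≤-antisym x≤x′ (+-cancelʳ-≤ y′ x′ x (≤-trans sum≤ (+-monoʳ-≤ x y≤y′))) ,
  ≤-antisym y≤y′ (+-cancelˡ-≤ x′ y′ y (≤-trans sum≤ (+-monoˡ-≤ y x≤x′)))

+-squeeze₄ : ∀ {a a′ b b′ c c′ d d′} → a ≤ a′ → b ≤ b′ → c ≤ c′ → d ≤ d′ →
             a′ + b′ + c′ + d′ ≤ a + b + c + d → a ≡ a′ × b ≡ b′ × c ≡ c′ × d ≡ d′
+-squeeze₄ a≤ b≤ c≤ d≤ sum≤ with +-squeeze (+-mono-≤ (+-mono-≤ a≤ b≤) c≤) d≤ sum≤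
... | abc≡ , d≡ with +-squeeze (+-mono-≤ a≤ b≤) c≤ (≤-reflexive (≡.sym abc≡))
...   | ab≡ , c≡ with +-squeeze a≤ b≤ (≤-reflexive (≡.sym ab≡))
...     | a≡ , b≡ = a≡ , b≡ , c≡ , d≡

switch-point : ∀ {n} {Q R : Fin (suc n) → Set} → Q zero → R (fromℕ n) →
               (∀ a → Q a ⊎ R a) → (∀ {a} → Q a → ¬ R a) → ∃[ a ] Q (inject₁ a) × R (suc a)
switch-point {zero} q r _ disjoint = ⊥-elim (disjoint q r)
switch-point {suc n} {Q} {R} q r cover disjoint with cover (suc zero)
... | inj₂ r₁ = zero , q , r₁
... | inj₁ q₁ with switch-point {n} {Q ∘ suc} {R ∘ suc} q₁ r (cover ∘ suc) disjoint
...   | a , qa , ra = suc a , qa , ra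

module Classical (em : ExcludedMiddle 0ℓ) where

  argmin : {A : Set} (P : A → Set) (μ : A → ℕ) (a : A) → P a →
           Σ A λ b → P b × (∀ c → P c → μ b ≤ μ c)
  argmin {A} P μ a pa = <-rec Goal step (μ a) refl pa
    where
    Goal : ℕ → Set
    Goal n = ∀ {a} → μ a ≡ n → P a → Σ A λ b → P b × (∀ c → P c → μ b ≤ μ c)
    step : ∀ n → (∀ {m} → m < n → Goal m) → Goal n
    step _ rec {a} refl pa with em {Σ A λ c → P c × μ c < μ a}
    ... | yes (c , pc , smaller) = rec smaller refl pc
    ... | no ∄smaller = a , pa , λ _ pc → ≮⇒≥ (λ smaller → ∄smaller (_ , pc , smaller))

  argmax : {A : Set} (P : A → Set) (μ : A → ℕ) (K : ℕ) → (∀ c → P c → μ c ≤ K) → (a : A) → P a →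
           Σ A λ b → P b × (∀ c → P c → μ c ≤ μ b)
  argmax P μ K bounded a pa with argmin P (λ c → K ∸ μ c) a pa
  ... | b , pb , min = b , pb , λ c pc → ∸-cancelʳ-≤ (bounded c pc) (min c pc)

  injective⇒eventually-≥ : {h : ℕ → ℕ} → Injective _≡_ _≡_ h →
                           ∀ M → ∃[ n₀ ] ∀ {n} → n₀ ≤ n → M ≤ h n
  injective⇒eventually-≥ inj zero = 0 , λ _ → z≤n
  injective⇒eventually-≥ {h} inj (suc M) with injective⇒eventually-≥ inj M
  ... | n₀ , above with em {∃[ n ] n₀ ≤ n × h n ≡ M}
  ...   | no never = n₀ , λ le → ≤∧≢⇒< (above le) (λ M≡ → never (_ , le , ≡.sym M≡))
  ...   | yes (n₁ , _ , hn₁≡M) = n₀ ⊔ suc n₁ , λ le →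
          ≤∧≢⇒< (above (≤-trans (m≤m⊔n n₀ (suc n₁)) le))
                (λ M≡ → <⇒≢ (≤-trans (m≤n⊔m n₀ (suc n₁)) le) (inj (trans hn₁≡M M≡)))

  preimage-of-list-bounded : {A : Set} {R : ℕ → A} → Injective _≡_ _≡_ R →
                             (xs : List A) → ∃[ B ] ∀ {j} → R j ∈ xs → j < B
  preimage-of-list-bounded inj [] = 0 , λ ()
  preimage-of-list-bounded {R = R} inj (x ∷ xs) with preimage-of-list-bounded inj xs | em {∃[ j ] R j ≡ x}
  ... | B , bound | no ∄j = B , λ { (here Rj≡x) → ⊥-elim (∄j (_ , Rj≡x)) ; (there j∈) → bound j∈ }
  ... | B , bound | yes (j₀ , Rj₀≡x) = suc j₀ ⊔ B , λ
        { (here Rj≡x) → ≤-trans (s≤s (≤-reflexive (inj (trans Rj≡x (≡.sym Rj₀≡x))))) (m≤m⊔n (suc j₀) B)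
        ; (there j∈) → ≤-trans (bound j∈) (m≤n⊔m (suc j₀) B) }

module _ (em : ExcludedMiddle 0ℓ) {G : Graph} (locFin : LocallyFinite G) where
  open Classical em

  neighbours-of-prefix-bounded : {R S : ℕ → V G} → Injective _≡_ _≡_ S →
    ∀ N → ∃[ B ] ∀ {i j} → i < N → Adj G (R i) (S j) → j < B
  neighbours-of-prefix-bounded inj zero = 0 , λ ()
  neighbours-of-prefix-bounded {R} {S} inj (suc N)
    with neighbours-of-prefix-bounded inj N | preimage-of-list-bounded inj (proj₁ (locFin (R N)))
  ... | B , old | B′ , new = B ⊔ B′ , bound
    where
    bound : ∀ {i j} → i < suc N → Adj G (R i) (S j) → j < B ⊔ B′
    bound i<1+N adj with m<1+n⇒m<n∨m≡n i<1+N
    ... | inj₁ i<N = ≤-trans (old i<N adj) (m≤m⊔n B B′)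
    ... | inj₂ refl = ≤-trans (new (proj₂ (locFin (R N)) _ adj)) (m≤n⊔m B B′)

edge-path : {G : Graph} {u v : V G} → Adj G u v → Path G
edge-path {G} {u} {v} uv = record { len = 1 ; vtx = ends ; inj = ends-injective ; adj = λ { zero → uv } }
  where
  ends : Fin 2 → V G
  ends zero = u
  ends (suc zero) = v
  ends-injective : ∀ a b → ends a ≡ ends b → a ≡ b
  ends-injective zero zero _ = refl
  ends-injective zero (suc zero) u≡v = ⊥-elim (irrefl G (subst (Adj G u) (≡.sym u≡v) uv))
  ends-injective (suc zero) zero v≡u = ⊥-elim (irrefl G (subst (Adj G u) v≡u uv))
  ends-injective (suc zero) (suc zero) _ = refl

edge-paths-disjoint : {G : Graph} {u v u′ v′ : V G} (uv : Adj G u v) (uv′ : Adj G u′ v′) →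
  u ≢ u′ → u ≢ v′ → v ≢ u′ → v ≢ v′ → VertexDisjoint G (edge-path uv) (edge-path uv′)
edge-paths-disjoint _ _ u≢u′ _ _ _ zero zero = u≢u′
edge-paths-disjoint _ _ _ u≢v′ _ _ zero (suc zero) = u≢v′
edge-paths-disjoint _ _ _ _ v≢u′ _ (suc zero) zero = v≢u′
edge-paths-disjoint _ _ _ _ _ v≢v′ (suc zero) (suc zero) = v≢v′

module _ {G : Graph} {S : V G → Bool} where

  induced-vertex-≡ : ∀ {u v} {p : T (S u)} {q : T (S v)} → u ≡ v →
                     _≡_ {A = V (InducedSubgraph G S)} (u , p) (v , q)
  induced-vertex-≡ refl = cong (_ ,_) (T-irrelevant _ _)

  induced-locallyFinite : LocallyFinite G → LocallyFinite (InducedSubgraph G S)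
  induced-locallyFinite locFin (v , _) =
    mapMaybe keep (proj₁ (locFin v)) ,
    λ (u , q) adj → mapMaybe⁺ keep _ (map⁺ (Any.map (kept q) (proj₂ (locFin v) u adj)))
    where
    keep : V G → Maybe (V (InducedSubgraph G S))
    keep u with T? (S u)
    ... | yes p = just (u , p)
    ... | no _ = nothing
    kept : ∀ {u} (q : T (S u)) {w} → u ≡ w → Maybe.Any ((u , q) ≡_) (keep w)
    kept {u} q refl with T? (S u)
    ... | yes _ = Maybe.just (induced-vertex-≡ refl)
    ... | no ∉S = ⊥-elim (∉S q)

  induced-ray-tail : {R : ℕ → V G} (c : ℕ) (inS : ∀ n → T (S (R (n + c)))) → InducedRay G R →
                     InducedRay (InducedSubgraph G S) (λ n → R (n + c) , inS n)
  induced-ray-tail c _ ((inj , step) , induced) =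
    ((λ i j eq → +-cancelʳ-≡ c i j (inj _ _ (cong proj₁ eq))) , λ i → step (i + c)) ,
    λ i j adj → Sum.map (+-cancelʳ-≡ c j (suc i)) (+-cancelʳ-≡ c i (suc j)) (induced (i + c) (j + c) adj)

MaximalIndepFullSequence : (G : Graph) (W X : ℕ → V G) → Set
MaximalIndepFullSequence G W X = Σ (ℕ → Cross G W X) λ s → IndepFullSeq G W X s × Maximal G W X s

InducedCrossFreeLadder : Graph → Set
InducedCrossFreeLadder G =
  Σ (V G → Bool) λ S → Σ (ℕ → V (InducedSubgraph G S)) λ W′ → Σ (ℕ → V (InducedSubgraph G S)) λ X′ →
    MessyLadder (InducedSubgraph G S) W′ X′ × CrossFree (InducedSubgraph G S) W′ X′

module Ladder (em : ExcludedMiddle 0ℓ) {G : Graph} {W X : ℕ → V G} (ladder : MessyLadder G W X) where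
  open Classical em
  open MessyLadder ladder

  Cr : Set
  Cr = Cross G W X

  loW hiW loX hiX : Cr → ℕ
  loW = wlo G W X
  hiW = whi G W X
  loX = xlo G W X
  hiX = xhi G W X

  _⊒_ : Cr → Cr → Set
  _⊒_ = SpansContain G W X

  IsFull : Cr → Set
  IsFull = Full G W X

  Indep : Cr → Cr → Set
  Indep = Independent G W X

  W-injective : Injective _≡_ _≡_ W
  W-injective = proj₁ (proj₁ railW) _ _

  X-injective : Injective _≡_ _≡_ X
  X-injective = proj₁ (proj₁ railX) _ _

  xBound wBound : ℕ → ℕ
  xBound N = proj₁ (neighbours-of-prefix-bounded em {G} locFin {R = W} {S = X} X-injective N)
  wBound N = proj₁ (neighbours-of-prefix-bounded em {G} locFin {R = X} {S = W} W-injective N)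

  xBound-correct : ∀ {N i j} → i < N → Adj G (W i) (X j) → j < xBound N
  xBound-correct {N} = proj₂ (neighbours-of-prefix-bounded em {G} locFin {R = W} {S = X} X-injective N)

  wBound-correct : ∀ {N i j} → j < N → Adj G (W i) (X j) → i < wBound N
  wBound-correct {N} j<N wx = proj₂ (neighbours-of-prefix-bounded em {G} locFin {R = X} {S = W} W-injective N) j<N (sym G wx)

  ⊒-refl : ∀ c → c ⊒ c
  ⊒-refl _ = ≤-refl , ≤-refl , ≤-refl , ≤-refl

  ⊒-trans : ∀ {b c d} → b ⊒ c → c ⊒ d → b ⊒ d
  ⊒-trans (p₁ , p₂ , p₃ , p₄) (q₁ , q₂ , q₃ , q₄) = ≤-trans p₁ q₁ , ≤-trans q₂ p₂ , ≤-trans p₃ q₃ , ≤-trans q₄ p₄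

  -- Strictly increasing along ⊒ among the crosses containing d; the truncated subtractions are
  -- harmless there, since such crosses start no later than d on either rail.
  spread : Cr → Cr → ℕ
  spread d c = hiW c + hiX c + (loW d ∸ loW c) + (loX d ∸ loX c)

  spread-bounded : ∀ d c → c ⊒ d → spread d c ≤ wBound (suc (loX d)) + xBound (suc (loW d)) + loW d + loX d
  spread-bounded d c (lo-w , _ , lo-x , _) =
    +-mono-≤ (+-mono-≤ (+-mono-≤ (<⇒≤ (wBound-correct (s≤s lo-x) (edg (f c))))
                                   (<⇒≤ (xBound-correct (s≤s lo-w) (edg (e c)))))
                        (m∸n≤m (loW d) (loW c)))
             (m∸n≤m (loX d) (loX c))

  max-spread⇒full : ∀ d c → c ⊒ d → (∀ c′ → c′ ⊒ d → spread d c′ ≤ spread d c) → IsFull c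
  max-spread⇒full d c c⊒d@(lo-w , _ , lo-x , _) max c′ c′⊒c@(lo-w′ , hi-w′ , lo-x′ , hi-x′)
    with +-squeeze₄ hi-w′ hi-x′ (∸-monoʳ-≤ (loW d) lo-w′) (∸-monoʳ-≤ (loX d) lo-x′) (max c′ (⊒-trans {c′} {c} {d} c′⊒c c⊒d))
  ... | hi-w≡ , hi-x≡ , lo-w≡ , lo-x≡ =
    ≡.sym (∸-cancelˡ-≡ lo-w (≤-trans lo-w′ lo-w) lo-w≡) , ≡.sym hi-w≡ ,
    ≡.sym (∸-cancelˡ-≡ lo-x (≤-trans lo-x′ lo-x) lo-x≡) , ≡.sym hi-x≡

  full-container : ∀ d → Σ Cr λ c → IsFull c × c ⊒ d
  full-container d with argmax (_⊒ d) (spread d) (wBound (suc (loX d)) + xBound (suc (loW d)) + loW d + loX d) (spread-bounded d) d (⊒-refl d)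
  ... | c , c⊒d , max = c , max-spread⇒full d c c⊒d max , c⊒d

  Indep-sym : ∀ c d → Indep c d → Indep d c
  Indep-sym _ _ (w , x) = Sum.swap w , Sum.swap x

  Indep-respʳ : ∀ c d d′ → SameCross G W X d d′ → Indep c d′ → Indep c d
  Indep-respʳ c _ _ (lo-w , hi-w , lo-x , hi-x) (w , x) =
    Sum.map (subst (hiW c ≤_) (≡.sym lo-w)) (subst (_≤ loW c) (≡.sym hi-w)) w ,
    Sum.map (subst (hiX c ≤_) (≡.sym lo-x)) (subst (_≤ loX c) (≡.sym hi-x)) x

  Eligible : List Cr → Cr → Set
  Eligible L c = IsFull c × All (Indep c) L

  Greedy : List Cr → Cr → Set
  Greedy L c = Eligible L c × (∀ c′ → Eligible L c′ → hiW c ≤ hiW c′)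

  extend : (L : List Cr) → Dec (Σ Cr (Eligible L)) → List Cr
  extend L (yes (c , el)) = proj₁ (argmin (Eligible L) hiW c el) ∷ L
  extend L (no _) = L

  extend-greedy : ∀ L (d : Dec (Σ Cr (Eligible L))) → Σ Cr (Eligible L) →
                  Σ Cr λ c → Greedy L c × extend L d ≡ c ∷ L
  extend-greedy L (yes (c , el)) _ = proj₁ least , proj₂ least , refl
    where
    least : Σ Cr (Greedy L)
    least = argmin (Eligible L) hiW c el
  extend-greedy L (no ∄el) el = ⊥-elim (∄el el)

  stage : ℕ → List Cr
  stage zero = []
  stage (suc n) = extend (stage n) em

  Stuck : Set
  Stuck = ∃[ n ] ¬ Σ Cr (Eligible (stage n))

  module GreedySequence (eligible : ∀ n → Σ Cr (Eligible (stage n))) where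

    s : ℕ → Cr
    s n = proj₁ (extend-greedy (stage n) em (eligible n))

    s-greedy : ∀ n → Greedy (stage n) (s n)
    s-greedy n = proj₁ (proj₂ (extend-greedy (stage n) em (eligible n)))

    stage-suc : ∀ n → stage (suc n) ≡ s n ∷ stage n
    stage-suc n = proj₂ (proj₂ (extend-greedy (stage n) em (eligible n)))

    s∈stage : ∀ {m n} → m < n → s m ∈ stage n
    s∈stage {m} {suc n} m<1+n with m<1+n⇒m<n∨m≡n m<1+n
    ... | inj₁ m<n = subst (s m ∈_) (≡.sym (stage-suc n)) (there (s∈stage m<n))
    ... | inj₂ refl = subst (s m ∈_) (≡.sym (stage-suc m)) (here refl)

    all-stage : {P : Cr → Set} → (∀ k → P (s k)) → ∀ n → All P (stage n)
    all-stage _ zero = []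
    all-stage {P} Ps (suc n) = subst (All P) (≡.sym (stage-suc n)) (Ps n ∷ all-stage Ps n)

    s-indep-earlier : ∀ {m n} → m < n → Indep (s n) (s m)
    s-indep-earlier m<n = All-lookup (proj₂ (proj₁ (s-greedy _))) (s∈stage m<n)

    -- s (1+n) was also eligible when s n was picked, so its W-span cannot lie below that of s n.
    hiW-increasing : ∀ n → hiW (s n) < hiW (s (suc n))
    hiW-increasing n with subst (All (Indep (s (suc n)))) (stage-suc n) (proj₂ (proj₁ (s-greedy (suc n))))
    ... | (inj₂ above , _) ∷ _ = ≤-<-trans above (ltW (s (suc n)))
    ... | (inj₁ below , _) ∷ earlier =
      ⊥-elim (<-irrefl refl (<-≤-trans (≤-<-trans below (ltW (s n)))
                                       (proj₂ (s-greedy n) (s (suc n)) (proj₁ (proj₁ (s-greedy (suc n))) , earlier))))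

    n≤hiW : ∀ n → n ≤ hiW (s n)
    n≤hiW zero = z≤n
    n≤hiW (suc n) = ≤-trans (s≤s (n≤hiW n)) (hiW-increasing n)

    s-indepFull : IndepFullSeq G W X s
    s-indepFull = (λ n → proj₁ (proj₁ (s-greedy n))) , λ m n m≢n → indep (<-cmp m n) m≢n
      where
      indep : ∀ {m n} → Tri (m < n) (m ≡ n) (n < m) → m ≢ n → Indep (s m) (s n)
      indep {m} {n} (tri< m<n _ _) _ = Indep-sym (s n) (s m) (s-indep-earlier m<n)
      indep (tri≈ _ m≡n _) m≢n = ⊥-elim (m≢n m≡n)
      indep (tri> _ _ n<m) _ = s-indep-earlier n<m

    s-maximal : Maximal G W X s
    s-maximal (t , (t-full , t-indep) , (g , _ , g-same , m , m∉g)) =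
      <-irrefl refl (≤-trans (n≤hiW N) (proj₂ (s-greedy N) (t m) (t-full m , all-stage t-indep-s N)))
      where
      N : ℕ
      N = suc (hiW (t m))
      t-indep-s : ∀ k → Indep (t m) (s k)
      t-indep-s k = Indep-respʳ (t m) (s k) (t (g k)) (g-same k) (t-indep m (g k) (λ m≡gk → m∉g k (≡.sym m≡gk)))

  ¬stuck⇒maximal-sequence : ¬ Stuck → MaximalIndepFullSequence G W X
  ¬stuck⇒maximal-sequence ¬stuck = s , s-indepFull , s-maximal
    where open GreedySequence (λ n → decidable-stable em (λ ∄el → ¬stuck (n , ∄el)))

  path-rung : (P : Path G) → Joins G W X P →
              Σ (Rung G W X) λ r → (∃[ a ] vtx P a ≡ W (wi r)) × (∃[ b ] vtx P b ≡ X (xj r))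
  path-rung P (starts , ends)
    with switch-point {Q = λ a → ∃[ i ] vtx P a ≡ W i} {R = λ a → ∃[ j ] vtx P a ≡ X j} starts ends
                      (λ a → covers (vtx P a)) (λ (i , onW) (j , onX) → disjoint i j (trans (≡.sym onW) onX))
  ... | a , (i , onW) , (j , onX) =
    rung i j (subst₂ (Adj G) onW onX (adj P a)) , (inject₁ a , onW) , (suc a , onX)

  paths : ℕ → Path G
  paths = proj₁ sameEnd

  shared-vertex⇒same-path : ∀ {m n a b} → vtx (paths m) a ≡ vtx (paths n) b → m ≡ n
  shared-vertex⇒same-path {m} {n} {a} {b} shared with m ≟ n
  ... | yes m≡n = m≡n
  ... | no m≢n = ⊥-elim (proj₂ (proj₂ sameEnd) m n m≢n a b shared)

  rung-on-path : ∀ n → Σ (Rung G W X) λ r →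
                 (∃[ a ] vtx (paths n) a ≡ W (wi r)) × (∃[ b ] vtx (paths n) b ≡ X (xj r))
  rung-on-path n = path-rung (paths n) (proj₁ (proj₂ sameEnd) n)

  ladder-rung : ℕ → Rung G W X
  ladder-rung n = proj₁ (rung-on-path n)

  ladder-rung-wi-injective : Injective _≡_ _≡_ (wi ∘ ladder-rung)
  ladder-rung-wi-injective {m} {n} eq with proj₁ (proj₂ (rung-on-path m)) | proj₁ (proj₂ (rung-on-path n))
  ... | _ , on-m | _ , on-n = shared-vertex⇒same-path (trans on-m (trans (cong W eq) (≡.sym on-n)))

  ladder-rung-xj-injective : Injective _≡_ _≡_ (xj ∘ ladder-rung)
  ladder-rung-xj-injective {m} {n} eq with proj₂ (proj₂ (rung-on-path m)) | proj₂ (proj₂ (rung-on-path n))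
  ... | _ , on-m | _ , on-n = shared-vertex⇒same-path (trans on-m (trans (cong X eq) (≡.sym on-n)))

  module Tail (a b : ℕ) (start : Adj G (W a) (X b)) where

    InTail : V G → Set
    InTail v = (∃[ i ] a ≤ i × v ≡ W i) ⊎ (∃[ j ] b ≤ j × v ≡ X j)

    S : V G → Bool
    S v = isYes (em {InTail v})

    G′ : Graph
    G′ = InducedSubgraph G S

    W-vertex : ∀ {i} → a ≤ i → V G′
    W-vertex {i} a≤i = W i , fromWitness {a? = em} (inj₁ (i , a≤i , refl))

    X-vertex : ∀ {j} → b ≤ j → V G′
    X-vertex {j} b≤j = X j , fromWitness {a? = em} (inj₂ (j , b≤j , refl))

    W′ X′ : ℕ → V G′
    W′ n = W-vertex (m≤n+m a n)
    X′ n = X-vertex (m≤n+m b n)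

    on-W′ : ∀ {i} → a ≤ i → {p : T (S (W i))} → ∃[ n ] _≡_ {A = V G′} (W i , p) (W′ n)
    on-W′ {i} a≤i = i ∸ a , induced-vertex-≡ {G} {S} (cong W (≡.sym (m∸n+n≡m a≤i)))

    on-X′ : ∀ {j} → b ≤ j → {p : T (S (X j))} → ∃[ n ] _≡_ {A = V G′} (X j , p) (X′ n)
    on-X′ {j} b≤j = j ∸ b , induced-vertex-≡ {G} {S} (cong X (≡.sym (m∸n+n≡m b≤j)))

    tail-covers : ∀ v → (∃[ i ] v ≡ W′ i) ⊎ (∃[ j ] v ≡ X′ j)
    tail-covers (v , p) with toWitness {a? = em {InTail v}} p
    ... | inj₁ (i , a≤i , refl) = inj₁ (on-W′ a≤i)
    ... | inj₂ (j , b≤j , refl) = inj₂ (on-X′ b≤j)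

    far-rungs : ∃[ n₀ ] ∀ {n} → n₀ ≤ n → a ≤ wi (ladder-rung n) × b ≤ xj (ladder-rung n)
    far-rungs with injective⇒eventually-≥ ladder-rung-wi-injective a
                 | injective⇒eventually-≥ ladder-rung-xj-injective b
    ... | n₁ , beyond-a | n₂ , beyond-b =
      n₁ ⊔ n₂ , λ le → beyond-a (m⊔n≤o⇒m≤o n₁ n₂ le) , beyond-b (m⊔n≤o⇒n≤o n₁ n₂ le)

    tail-rung : ℕ → Rung G W X
    tail-rung k = ladder-rung (proj₁ far-rungs + k)

    tail-rung-far : ∀ k → a ≤ wi (tail-rung k) × b ≤ xj (tail-rung k)
    tail-rung-far k = proj₂ far-rungs (m≤m+n (proj₁ far-rungs) k)

    W-end X-end : ℕ → V G′
    W-end k = W-vertex (proj₁ (tail-rung-far k))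
    X-end k = X-vertex (proj₂ (tail-rung-far k))

    rung-path : ℕ → Path G′
    rung-path k = edge-path {G′} {W-end k} {X-end k} (edg (tail-rung k))

    rung-paths-disjoint : ∀ m n → m ≢ n → VertexDisjoint G′ (rung-path m) (rung-path n)
    rung-paths-disjoint m n m≢n =
      edge-paths-disjoint {G′} {W-end m} {X-end m} {W-end n} {X-end n} (edg (tail-rung m)) (edg (tail-rung n))
        (λ eq → m≢n (+-cancelˡ-≡ _ m n (ladder-rung-wi-injective (W-injective (cong proj₁ eq)))))
        (λ eq → disjoint _ _ (cong proj₁ eq))
        (λ eq → disjoint _ _ (≡.sym (cong proj₁ eq)))
        (λ eq → m≢n (+-cancelˡ-≡ _ m n (ladder-rung-xj-injective (X-injective (cong proj₁ eq)))))

    tail-ladder : MessyLadder G′ W′ X′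
    tail-ladder = record
      { locFin   = induced-locallyFinite {G} {S} locFin
      ; railW    = induced-ray-tail {G} {S} a (proj₂ ∘ W′) railW
      ; railX    = induced-ray-tail {G} {S} b (proj₂ ∘ X′) railX
      ; disjoint = λ i j eq → disjoint (i + a) (j + b) (cong proj₁ eq)
      ; covers   = tail-covers
      ; sameEnd  = rung-path , (λ k → on-W′ (proj₁ (tail-rung-far k)) , on-X′ (proj₂ (tail-rung-far k))) ,
                   rung-paths-disjoint
      ; initial  = start
      }

    tail-cross-free : (∀ c → loW c < a) → CrossFree G′ W′ X′
    tail-cross-free before-a c′ = <⇒≱ (before-a lifted) (m≤n+m a (wi (e c′)))
      where
      lifted : Cr
      lifted = cross (rung (wi (e c′) + a) (xj (e c′) + b) (edg (e c′)))
                     (rung (wi (f c′) + a) (xj (f c′) + b) (edg (f c′)))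
                     (+-monoˡ-< a (ltW c′)) (+-monoˡ-< b (ltX c′))

  span-top : List Cr → ℕ
  span-top [] = 0
  span-top (d ∷ L) = hiW d ⊔ hiX d ⊔ span-top L

  beyond-span-top⇒independent : ∀ L c → span-top L ≤ loW c → span-top L ≤ loX c → All (Indep c) L
  beyond-span-top⇒independent [] _ _ _ = []
  beyond-span-top⇒independent (d ∷ L) c w x =
    (inj₂ (m⊔n≤o⇒m≤o (hiW d) (hiX d) (m⊔n≤o⇒m≤o _ (span-top L) w)) ,
     inj₂ (m⊔n≤o⇒n≤o (hiW d) (hiX d) (m⊔n≤o⇒m≤o _ (span-top L) x))) ∷
    beyond-span-top⇒independent L c (m⊔n≤o⇒n≤o _ (span-top L) w) (m⊔n≤o⇒n≤o _ (span-top L) x)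

  module Blocked (L : List Cr) (blocked : ¬ Σ Cr (Eligible L)) where

    full-near-origin : ∀ c → IsFull c → loW c < span-top L ⊎ loX c < span-top L
    full-near-origin c full with span-top L ≤? loW c | span-top L ≤? loX c
    ... | yes w | yes x = ⊥-elim (blocked (c , full , beyond-span-top⇒independent L c w x))
    ... | no w  | _     = inj₁ (≰⇒> w)
    ... | yes _ | no x  = inj₂ (≰⇒> x)

    cross-bound : ℕ
    cross-bound = wBound (span-top L) ⊔ wBound (xBound (span-top L))

    full-hiW-bounded : ∀ c → IsFull c → hiW c < cross-bound
    full-hiW-bounded c full with full-near-origin c full
    ... | inj₁ w = ≤-trans (wBound-correct (<-trans (ltX c) (xBound-correct w (edg (e c)))) (edg (f c)))
                           (m≤n⊔m (wBound (span-top L)) _)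
    ... | inj₂ x = ≤-trans (wBound-correct x (edg (f c))) (m≤m⊔n _ (wBound (xBound (span-top L))))

    hiW-bounded : ∀ d → hiW d < cross-bound
    hiW-bounded d with full-container d
    ... | c , full , (_ , hi-w , _ , _) = ≤-<-trans hi-w (full-hiW-bounded c full)

    cross-free-tail : InducedCrossFreeLadder G
    cross-free-tail = S , W′ , X′ , tail-ladder ,
                      tail-cross-free (λ c → <-≤-trans (<-trans (ltW c) (hiW-bounded c)) cross-bound≤a)
      where
      n : ℕ
      n = proj₁ (injective⇒eventually-≥ ladder-rung-wi-injective cross-bound)
      cross-bound≤a : cross-bound ≤ wi (ladder-rung n)
      cross-bound≤a = proj₂ (injective⇒eventually-≥ ladder-rung-wi-injective cross-bound) ≤-refl
      open Tail (wi (ladder-rung n)) (xj (ladder-rung n)) (edg (ladder-rung n))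

  stuck⇒cross-free-tail : Stuck → InducedCrossFreeLadder G
  stuck⇒cross-free-tail (n , blocked) = Blocked.cross-free-tail (stage n) blocked

lemma4p3 : ExcludedMiddle 0ℓ → (G : Graph) (W X : ℕ → V G) → MessyLadder G W X →
    (Σ (ℕ → Cross G W X) λ s → IndepFullSeq G W X s × Maximal G W X s)
    ⊎ (Σ (V G → Bool) λ S → Σ (ℕ → V (InducedSubgraph G S)) λ W′ → Σ (ℕ → V (InducedSubgraph G S)) λ X′ →
        MessyLadder (InducedSubgraph G S) W′ X′ × CrossFree (InducedSubgraph G S) W′ X′)
lemma4p3 em G W X ladder with em {Ladder.Stuck em ladder}
... | yes stuck = inj₂ (Ladder.stuck⇒cross-free-tail em ladder stuck)
... | no ¬stuck = inj₁ (Ladder.¬stuck⇒maximal-sequence em ladder ¬stuck)
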